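{- Let $G$ be a finite simple graph with no ds-completable vertex. Let $i$ be a vertex set such that $\bar{i} = V \setminus i$ is neighbourly and $\epsilon(i, \bar{i}) = m_i$ (that is, every edge incident to a vertex of $i$ has its other end in $\bar{i}$). Let $p = \bar{i} \cap D$ and $n_p = |p|$. Then $$\epsilon(i,p) \le \sum_{v \in i} \min(d_v, n_p - 1).$$
   Context: $V$ is the vertex set, $d_x$ the degree of $x$, $m_i = \sum_{x \in i} d_x$. A vertex is dull if $G$ contains a vertex of degree one more than its degree; $D$ is the set of dull vertices. A vertex $v$ is ds-completable if, for each integer $d$, the vertices having degree $d$ in $G-v$ are either all neighbours of $v$ in $G$ or all non-neighbours. A vertex set $K$ is neighbourly if $\{d_u : u \notin K\} \cap \{d_u - 1 : u \in K\} = \emptyset$. $\epsilon(j,k) = \sum_{x \in j} |N(x) \cap k|$. -}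

module Defs where

open import Data.Nat using (ℕ; zero; suc; _+_; _∸_; _⊓_; _≤_)
open import Data.Bool using (Bool; true; false; not; _∧_; if_then_else_)
open import Data.Fin using (Fin; zero; suc)
open import Data.Product using (∃; _×_; _,_)
open import Data.Sum using (_⊎_)
open import Relation.Binary.PropositionalEquality using (_≡_; _≢_)

record Graph (n : ℕ) : Set where
  field
    adj     : Fin n → Fin n → Bool
    sym     : ∀ x y → adj x y ≡ adj y x
    irrefl  : ∀ x → adj x x ≡ false
open Graph public

sumFin : ∀ {n} → (Fin n → ℕ) → ℕ
sumFin {zero}  f = 0
sumFin {suc n} f = f zero + sumFin (λ i → f (suc i))

VSet : ℕ → Set
VSet n = Fin n → Bool

ind : Bool → ℕ
ind true  = 1
ind false = 0

sumOver : ∀ {n} → VSet n → (Fin n → ℕ) → ℕ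
sumOver j f = sumFin (λ x → if j x then f x else 0)

card : ∀ {n} → VSet n → ℕ
card j = sumFin (λ x → ind (j x))

compl : ∀ {n} → VSet n → VSet n
compl j x = not (j x)

_∩_ : ∀ {n} → VSet n → VSet n → VSet n
(j ∩ k) x = j x ∧ k x

module _ {n : ℕ} (G : Graph n) where

  deg : Fin n → ℕ
  deg x = sumFin (λ y → ind (adj G x y))

  mass : VSet n → ℕ
  mass i = sumOver i deg

  ε : VSet n → VSet n → ℕ
  ε j k = sumOver j (λ x → card (λ y → adj G x y ∧ k y))

  Dull : Fin n → Set
  Dull x = ∃ λ y → deg y ≡ suc (deg x)

  -- degree of u in G - v (for u ≠ v)
  degMinus : Fin n → Fin n → ℕ
  degMinus v u = deg u ∸ ind (adj G u v)

  DsCompletable : Fin n → Set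
  DsCompletable v = ∀ (d : ℕ) →
      (∀ u → u ≢ v → degMinus v u ≡ d → adj G v u ≡ true)
    ⊎ (∀ u → u ≢ v → degMinus v u ≡ d → adj G v u ≡ false)

  Neighbourly : VSet n → Set
  Neighbourly K = ∀ u w → K u ≡ false → K w ≡ true → suc (deg u) ≢ deg w

-- The bound is proved vertex by vertex: for every v ∈ i we
-- show |N(v) ∩ p| ≤ min(d_v, n_p - 1), and sum over i.  The bound by d_v
-- is trivial; the bound by n_p - 1 says that no v ∈ i is adjacent to all
-- of p.  That follows from a general criterion: a vertex v is
-- ds-completable as soon as no neighbour of v has degree exactly one more
-- than a non-neighbour of v ("v has no degree gap").  If v ∈ i were
-- adjacent to all of p and u₀ ∈ N(v), u ∉ N(v) had d_{u₀} = d_u + 1, then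
-- u is dull; u ∉ ī since otherwise u ∈ p ⊆ N(v); so u ∈ i, while
-- u₀ ∈ ī because ε(i, ī) = m_i puts all neighbours of i-vertices in ī.
-- This contradicts the neighbourliness of ī.
module Submission where

open import Defs
open import Data.Nat using (ℕ; suc; _≤_; _<_; _∸_; _⊓_; z≤n; s≤s)
open import Data.Nat.Properties
  using (≤-refl; ≤-trans; +-mono-≤; +-mono-<-≤; +-mono-≤-<; ⊓-glb; ∸-monoˡ-≤; <-irrefl; _≟_)
open import Data.Bool using (Bool; true; false; not; _∧_; if_then_else_)
open import Data.Bool.Properties using () renaming (_≟_ to _≟ᵇ_)
open import Data.Fin using (Fin; zero; suc)
open import Data.Fin.Properties using (any?)
open import Data.Product using (∃; _×_; _,_)
open import Data.Sum using (inj₁; inj₂)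
open import Data.Empty using (⊥-elim)
open import Relation.Nullary using (¬_; yes; no)
open import Relation.Nullary.Decidable using (_×-dec_)
open import Relation.Binary.PropositionalEquality
  using (_≡_; _≢_; refl; trans; cong; subst) renaming (sym to ≡-sym)

sum-mono : ∀ {n} {f g : Fin n → ℕ} → (∀ x → f x ≤ g x) → sumFin f ≤ sumFin g
sum-mono {ℕ.zero} le = z≤n
sum-mono {suc n}  le = +-mono-≤ (le zero) (sum-mono (λ x → le (suc x)))

sum-strict : ∀ {n} {f g : Fin n → ℕ} → (∀ x → f x ≤ g x) →
             ∀ w → f w < g w → sumFin f < sumFin g
sum-strict le zero    lt = +-mono-<-≤ lt (sum-mono (λ x → le (suc x)))
sum-strict le (suc w) lt = +-mono-≤-< (le zero) (sum-strict (λ x → le (suc x)) w lt)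

if-mono : ∀ (c : Bool) {a b : ℕ} → (c ≡ true → a ≤ b) →
          (if c then a else 0) ≤ (if c then b else 0)
if-mono true  le = le refl
if-mono false le = z≤n

sumOver-mono : ∀ {n} (j : VSet n) {f g : Fin n → ℕ} →
               (∀ x → j x ≡ true → f x ≤ g x) → sumOver j f ≤ sumOver j g
sumOver-mono j le = sum-mono (λ x → if-mono (j x) (le x))

sumOver-strict : ∀ {n} (j : VSet n) {f g : Fin n → ℕ} →
                 (∀ x → j x ≡ true → f x ≤ g x) →
                 ∀ w → j w ≡ true → f w < g w → sumOver j f < sumOver j g
sumOver-strict j {f} {g} le w jw lt =
  sum-strict (λ x → if-mono (j x) (le x)) w
    (subst (λ c → (if c then f w else 0) < (if c then g w else 0)) (≡-sym jw) lt)

_⊆_ : ∀ {n} → VSet n → VSet n → Set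
j ⊆ k = ∀ x → j x ≡ true → k x ≡ true

false≢true : false ≢ true
false≢true ()

ind-mono : ∀ {a b : Bool} → (a ≡ true → b ≡ true) → ind a ≤ ind b
ind-mono {false}         _  = z≤n
ind-mono {true}  {false} ab = ⊥-elim (false≢true (ab refl))
ind-mono {true}  {true}  _  = ≤-refl

card-mono : ∀ {n} {j k : VSet n} → j ⊆ k → card j ≤ card k
card-mono j⊆k = sum-mono (λ x → ind-mono (j⊆k x))

card-strict : ∀ {n} {j k : VSet n} → j ⊆ k →
              ∀ w → j w ≡ false → k w ≡ true → card j < card k
card-strict j⊆k w jw kw = sum-strict (λ x → ind-mono (j⊆k x)) w (ind-< jw kw)
  where
    ind-< : ∀ {a b} → a ≡ false → b ≡ true → ind a < ind b
    ind-< refl refl = s≤s z≤n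

∩-⊆ˡ : ∀ {n} (j k : VSet n) → (j ∩ k) ⊆ j
∩-⊆ˡ j k x jk with j x
... | true = refl

∩-⊆ʳ : ∀ {n} (j k : VSet n) → (j ∩ k) ⊆ k
∩-⊆ʳ j k x jk with j x
... | true = jk

module _ {n : ℕ} (G : Graph n) where

  N : Fin n → VSet n
  N v = adj G v

  -- ε(j,k) ≤ m_j always; equality forces every neighbour of a vertex of
  -- j to lie in k, since a neighbour u ∉ k of v ∈ j would make the
  -- summand |N(v) ∩ k| strictly smaller than d_v.
  ε-full⇒N⊆ : ∀ {j k} → ε G j k ≡ mass G j →
              ∀ {v u} → j v ≡ true → adj G v u ≡ true → k u ≡ true
  ε-full⇒N⊆ {j} {k} full {v} {u} jv vu with k u in ku
  ... | true  = refl
  ... | false = ⊥-elim (<-irrefl full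
        (sumOver-strict j (λ x _ → card-mono (∩-⊆ˡ (N x) k)) v jv
          (card-strict (∩-⊆ˡ (N v) k) u (subst (λ b → b ∧ k u ≡ false) (≡-sym vu) ku) vu)))

  deg-pos : ∀ {x y} → adj G x y ≡ true → 1 ≤ deg G x
  deg-pos {x} {y} xy = ≤-trans (s≤s z≤n) (card-strict {j = λ _ → false} (λ _ ()) y refl xy)

  degMinus-adj : ∀ {v u d} → adj G v u ≡ true → degMinus G v u ≡ d → deg G u ≡ suc d
  degMinus-adj {v} {u} vu eq =
    pred-inverse (deg-pos uv) (subst (λ b → deg G u ∸ ind b ≡ _) uv eq)
    where
      uv : adj G u v ≡ true
      uv = trans (Graph.sym G u v) vu
      pred-inverse : ∀ {m d} → 1 ≤ m → m ∸ 1 ≡ d → m ≡ suc d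
      pred-inverse (s≤s _) refl = refl

  degMinus-nonadj : ∀ {v u d} → adj G v u ≡ false → degMinus G v u ≡ d → deg G u ≡ d
  degMinus-nonadj {v} {u} vu eq =
    subst (λ b → deg G u ∸ ind b ≡ _) (trans (Graph.sym G u v) vu) eq

  DegreeGap : Fin n → Set
  DegreeGap v = ∃ λ u₀ → ∃ λ u →
    adj G v u₀ ≡ true × adj G v u ≡ false × deg G u₀ ≡ suc (deg G u)

  -- Criterion: a vertex without a degree gap is ds-completable.  For each
  -- d, either some neighbour of v has degree d in G - v, and then no
  -- non-neighbour can, or no neighbour has.
  no-gap⇒dsCompletable : ∀ v → ¬ DegreeGap v → DsCompletable G v
  no-gap⇒dsCompletable v noGap d
    with any? (λ u₀ → (adj G v u₀ ≟ᵇ true) ×-dec (degMinus G v u₀ ≟ d))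
  ... | yes (u₀ , vu₀ , eq₀) = inj₁ λ u _ eq → adjacent u eq
    where
      adjacent : ∀ u → degMinus G v u ≡ d → adj G v u ≡ true
      adjacent u eq with adj G v u in vu
      ... | true  = refl
      ... | false = ⊥-elim (noGap (u₀ , u , vu₀ , vu ,
                      trans (degMinus-adj vu₀ eq₀) (cong suc (≡-sym (degMinus-nonadj vu eq)))))
  ... | no none = inj₂ λ u _ eq → nonadjacent u eq
    where
      nonadjacent : ∀ u → degMinus G v u ≡ d → adj G v u ≡ false
      nonadjacent u eq with adj G v u in vu
      ... | false = refl
      ... | true  = ⊥-elim (none (u , vu , eq))

module DullOutside {n : ℕ} (G : Graph n) (i : VSet n)
  (neighbourly : Neighbourly G (compl i)) (closed : ε G i (compl i) ≡ mass G i)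
  (D : VSet n) (dull⇒D : ∀ x → Dull G x → D x ≡ true) where

  p : VSet n
  p = compl i ∩ D

  -- A vertex of i adjacent to all of p has no degree gap: the lower end
  -- u of a gap is dull, so it lies in i (not in p ⊆ N(v)), while the
  -- upper end is a neighbour of v ∈ i and hence lies in ī.
  covers-p⇒no-gap : ∀ {v} → i v ≡ true → p ⊆ N G v → ¬ DegreeGap G v
  covers-p⇒no-gap {v} iv p⊆N (u₀ , u , vu₀ , vu , gap) with i u in iu
  ... | true  = neighbourly u u₀ (cong not iu) (ε-full⇒N⊆ G closed iv vu₀) (≡-sym gap)
  ... | false = false≢true (trans (≡-sym vu) (p⊆N u u∈p))
    where
      u∈p : p u ≡ true
      u∈p = subst (λ b → not b ∧ D u ≡ true) (≡-sym iu) (dull⇒D u (u₀ , gap))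

  misses-p : ∀ {v} → ¬ DsCompletable G v → i v ≡ true →
             ∃ λ w → p w ≡ true × adj G v w ≡ false
  misses-p {v} notDs iv with any? (λ w → (p w ≟ᵇ true) ×-dec (adj G v w ≟ᵇ false))
  ... | yes missed = missed
  ... | no none    = ⊥-elim (notDs (no-gap⇒dsCompletable G v (covers-p⇒no-gap iv covered)))
    where
      covered : p ⊆ N G v
      covered w pw with adj G v w in vw
      ... | true  = refl
      ... | false = ⊥-elim (none (w , pw , vw))

  N∩p-bound : ∀ {v} → ¬ DsCompletable G v → i v ≡ true → card (N G v ∩ p) ≤ card p ∸ 1
  N∩p-bound {v} notDs iv with misses-p notDs iv
  ... | w , pw , vw =
    ∸-monoˡ-≤ 1 (card-strict (∩-⊆ʳ (N G v) p) w (subst (λ b → b ∧ p w ≡ false) (≡-sym vw) refl) pw)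

lemma8 : ∀ {n} (G : Graph n) →
    (∀ v → ¬ DsCompletable G v) →
    (i : VSet n) → Neighbourly G (compl i) → ε G i (compl i) ≡ mass G i →
    (D : VSet n) → (∀ x → D x ≡ true → Dull G x) → (∀ x → Dull G x → D x ≡ true) →
    ε G i (compl i ∩ D) ≤ sumOver i (λ v → deg G v ⊓ (card (compl i ∩ D) ∸ 1))
lemma8 G noDs i neighbourly closed D _ dull⇒D =
  sumOver-mono i λ v iv →
    ⊓-glb (card-mono (∩-⊆ˡ (N G v) p)) (N∩p-bound (noDs v) iv)
  where open DullOutside G i neighbourly closed D dull⇒D
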